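{- Let $G=(V,A)$ be an $n$-vertex permutation DAG, $\gamma$ an umbrella-free topological ordering of $G$, and $\sigma$ the sequence returned by $\mathtt{GreedyAssign}(G,\gamma)$. Let $\mathsf{PermDAG}(\sigma)=(\{t_1,\ldots,t_n\},A')$. Then $\mathsf{PermDAG}(\sigma)$ is isomorphic to $G$ under the mapping $\phi:\{t_1,\ldots,t_n\}\to V$ given by $\phi(t_i)=\gamma^{ -1}(i)$.
   Context: $\mathsf{PermDAG}(\sigma)$ has vertices $t_1,\ldots,t_n$ and an arc $(t_j,t_i)$ for every $i<j$ with $\sigma(i)\le\sigma(j)$; a permutation DAG is a directed graph isomorphic to some $\mathsf{PermDAG}(\tau)$. A topological ordering of an $n$-vertex DAG $G=(V,A)$ is a bijection $\gamma:V\to[n]$ with $\gamma(u)<\gamma(v)$ for every arc $(v,u)\in A$; it is umbrella-free if for every $(v,u)\in A$ and every $w$ with $\gamma(u)<\gamma(w)<\gamma(v)$, $(w,u)\in A$ or $(v,w)\in A$. Given a DAG $H$ and an ordering $\gamma_H$ of its vertices, a vertex $u$ is fully suffix connected if $(v,u)$ is an arc for every $v$ with $\gamma_H(v)>\gamma_H(u)$, and the $\gamma_H$-LFSC vertex is the fully suffix connected vertex with smallest $\gamma_H$-value. Algorithm $\mathtt{GreedyAssign}(G,\gamma)$: set $\alpha\leftarrow 1$, $G_1\leftarrow G$, $\gamma_1\leftarrow\gamma$, $\gamma(v_0)\leftarrow-\infty$. For $i=1,\ldots,n$: let $v_i$ be the $\gamma_i$-LFSC vertex of $G_i$; if $\gamma(v_i)<\gamma(v_{i-1})$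 then $\alpha\leftarrow\alpha+1$; set $G_{i+1}\leftarrow G_i-v_i$ and let $\gamma_{i+1}$ be the ordering of $V(G_{i+1})$ inheriting the relative order of $\gamma_i$ (i.e. values above $\gamma_i(v_i)$ decreased by one); set $\sigma(v_i)\leftarrow\alpha$. Return the sequence $\sigma=(\sigma(\gamma^{ -1}(1)),\ldots,\sigma(\gamma^{ -1}(n)))$. -}

module Defs where

open import Data.Nat using (ℕ; zero; suc; _≤_; _<?_)
open import Data.Fin using (Fin; toℕ; _<_; _≟_)

open import Data.List using (List; []; _∷_; map; allFin)
open import Data.List.Relation.Unary.All using (all?)
open import Data.Maybe using (Maybe; just; nothing)
open import Data.Product using (Σ; _×_; _,_; ∃)
open import Data.Sum using (_⊎_)
open import Relation.Nullary using (yes; no; does)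
open import Relation.Binary using (Decidable)
open import Function.Bundles using (_↔_; _⇔_; Inverse)
open import Data.Bool using (if_then_else_)

-- A digraph on the vertex set Fin n is given by its arc relation:
-- Arc v u  means  (v , u) ∈ A.
Digraph : ℕ → Set₁
Digraph n = Fin n → Fin n → Set

-- PermDAG of a sequence s = (s(1),...,s(n)) (indices 0-based here):
-- vertices t_1..t_n (as Fin n), arc (t_j , t_i) iff i < j and s(i) ≤ s(j).
PermArc : {n : ℕ} → (Fin n → ℕ) → Digraph n
PermArc s j i = (i < j) × (s i ≤ s j)

IsIso : {n : ℕ} → Digraph n → Digraph n → (Fin n → Fin n) → Set
IsIso {n} H G φ = (a b : Fin n) → H a b ⇔ G (φ a) (φ b)

IsPermutationDAG : {n : ℕ} → Digraph n → Set
IsPermutationDAG {n} G =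
  Σ (Fin n ↔ Fin n) λ τ → Σ (Fin n ↔ Fin n) λ ψ →
    IsIso (PermArc (λ i → suc (toℕ (Inverse.to τ i)))) G (Inverse.to ψ)

Ordering : ℕ → Set
Ordering n = Fin n ↔ Fin n

module _ {n : ℕ} (G : Digraph n) (γ : Ordering n) where
  private
    g = Inverse.to γ

  IsTopological : Set
  IsTopological = ∀ u v → G v u → g u < g v

  IsUmbrellaFree : Set
  IsUmbrellaFree = ∀ u v w → G v u → g u < g w → g w < g v → G w u ⊎ G v w

module Greedy {n : ℕ} (G : Digraph n) (G? : Decidable G) (γ : Ordering n) where
  private
    g = Inverse.to γ
    g⁻¹ = Inverse.from γ

  -- Given the remaining vertices listed in increasing γ-order, return the
  -- LFSC vertex (first u such that every later vertex v has arc (v,u))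
  -- together with the remaining list with u removed.
  pick : List (Fin n) → Maybe (Fin n × List (Fin n))
  pick [] = nothing
  pick (u ∷ rest) with all? (λ v → G? v u) rest
  ... | yes _ = just (u , rest)
  ... | no _ with pick rest
  ...   | nothing = nothing
  ...   | just (v , rest') = just (v , u ∷ rest')

  -- main loop: fuel, remaining list, previous vertex (nothing = -∞),
  -- current α, current assignment σ.
  -- new value of α when v_i = v and v_{i-1} = prev
  nextα : Maybe (Fin n) → Fin n → ℕ → ℕ
  nextα nothing v α = α
  nextα (just p) v α = if does (toℕ (g v) <? toℕ (g p)) then suc α else α

  update : (Fin n → ℕ) → Fin n → ℕ → (Fin n → ℕ)
  update σ v a w = if does (w ≟ v) then a else σ w

  loop : ℕ → List (Fin n) → Maybe (Fin n) → ℕ → (Fin n → ℕ) → (Fin n → ℕ)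
  loop zero L prev α σ = σ
  loop (suc k) L prev α σ with pick L
  ... | nothing = σ
  ... | just (v , L') =
        loop k L' (just v) (nextα prev v α) (update σ v (nextα prev v α))

  assignment : Fin n → ℕ
  assignment = loop n (map g⁻¹ (allFin n)) nothing 1 (λ _ → 0)

  greedyAssign : Fin n → ℕ
  greedyAssign i = assignment (g⁻¹ i)

GreedyAssign : {n : ℕ} (G : Digraph n) → Decidable G → Ordering n → Fin n → ℕ
GreedyAssign G G? γ = Greedy.greedyAssign G G? γ

-- The γ-LFSC vertex v
-- picked from the remaining vertices has no arc into them (a descent argument
-- using umbrella-freeness), so the processed vertices stay closed under arcs,
-- while each remaining vertex has an arc to every processed vertex γ-before it.
-- The label α grows exactly when v lies γ-before its predecessor, which makes
-- every processed vertex γ-after v carry a smaller label than v; together these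
-- say that, between processed vertices, an arc y → x with x γ-before y exists
-- iff σ x ≤ σ y, i.e. the arcs of PermDAG(σ).
module Submission where

open import Defs
open import Data.Nat using (ℕ)
open import Relation.Binary using (Decidable)
open import Function.Bundles using (Inverse)

open import Data.Nat using (zero; suc; s≤s; _≤_; _<_; _∸_; _<ᵇ_; _≟_; ≤-pred)
open import Data.Nat.Properties
  using (≤-refl; ≤-trans; <-≤-trans; <-trans; n≤1+n; <⇒≤; ≤∧≢⇒<; <-cmp; ≮⇒≥; <-irrefl; <⇒≱; <⇒<ᵇ; ≤-reflexive; ∸-monoʳ-<)
open import Data.Nat.Induction using (<-wellFounded)
open import Data.Fin using (Fin; toℕ) renaming (_≟_ to _≟ᶠ_)
open import Data.Fin.Properties using (toℕ-injective)
open import Data.List using (List; []; _∷_; map; allFin; length)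
open import Data.List.Properties using (length-map; length-tabulate)
open import Data.List.Relation.Unary.All as All using (all?)
open import Data.List.Relation.Unary.All.Properties using (¬All⇒Any¬)
open import Data.List.Relation.Unary.AllPairs using (AllPairs; _∷_)
open import Data.List.Relation.Unary.AllPairs.Properties using (map⁺; tabulate⁺-<)
open import Data.List.Relation.Unary.Any using (here; there)
open import Data.List.Membership.Propositional using (_∈_; _∉_; find)
open import Data.List.Membership.Propositional.Properties using (∈-map⁺; ∈-allFin)
open import Data.Maybe using (Maybe; just; nothing)
open import Data.Product using (_×_; _,_; ∃; proj₁; proj₂)
open import Data.Sum using ([_,_]′)
open import Data.Bool using (true; false; T)
open import Data.Empty using (⊥-elim)
open import Induction.WellFounded using (Acc; acc)
open import Relation.Nullary using (¬_; yes; no)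
open import Relation.Binary using (Transitive; tri<; tri≈; tri>)
open import Relation.Binary.PropositionalEquality
open import Function.Bundles using (_↔_; Equivalence; Injection; mk⇔)
open import Function.Properties.Inverse using (↔⇒↣)

PermArc-trans : ∀ {n} (s : Fin n → ℕ) → Transitive (PermArc s)
PermArc-trans s (b<a , sb≤sa) (c<b , sc≤sb) = <-trans c<b b<a , ≤-trans sc≤sb sb≤sa

IsIso-trans : ∀ {n} {H G : Digraph n} (φ : Fin n ↔ Fin n) →
              IsIso H G (Inverse.to φ) → Transitive H → Transitive G
IsIso-trans {H = H} {G} φ iso H-trans Gab Gbc =
  toG (Equivalence.to (iso _ _) (H-trans (fromG Gab) (fromG Gbc)))
  where
    open Inverse φ using (to; from; strictlyInverseˡ)
    fromG : ∀ {u v} → G u v → H (from u) (from v)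
    fromG {u} {v} Guv =
      Equivalence.from (iso (from u) (from v)) (subst₂ G (sym (strictlyInverseˡ u)) (sym (strictlyInverseˡ v)) Guv)
    toG : ∀ {u v} → G (to (from u)) (to (from v)) → G u v
    toG {u} {v} = subst₂ G (strictlyInverseˡ u) (strictlyInverseˡ v)

IsPermutationDAG⇒trans : ∀ {n} (G : Digraph n) → IsPermutationDAG G → Transitive G
IsPermutationDAG⇒trans G (_ , ψ , iso) = IsIso-trans {G = G} ψ iso (PermArc-trans _)

module GreedyAssignCorrect {n : ℕ} (G : Digraph n) (G? : Decidable G) (γ : Ordering n)
  (G-trans : Transitive G) (topological : IsTopological G γ) (umbrellaFree : IsUmbrellaFree G γ) where

  open Greedy G G? γ
  open Inverse γ using (strictlyInverseˡ; strictlyInverseʳ) renaming (to to g; from to g⁻¹)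

  pos : Fin n → ℕ
  pos x = toℕ (g x)

  pos-injective : ∀ {x y} → pos x ≡ pos y → x ≡ y
  pos-injective eq = Injection.injective (↔⇒↣ γ) (toℕ-injective eq)

  pos-g⁻¹ : ∀ i → pos (g⁻¹ i) ≡ toℕ i
  pos-g⁻¹ i = cong toℕ (strictlyInverseˡ i)

  irreflexive : ∀ {v} → ¬ G v v
  irreflexive Gvv = <-irrefl refl (topological _ _ Gvv)

  Sorted : List (Fin n) → Set
  Sorted = AllPairs (λ x y → pos x < pos y)

  FullySuffixConnected : List (Fin n) → Fin n → Set
  FullySuffixConnected L u = ∀ {y} → y ∈ L → pos u < pos y → G y u

  SuffixGap : List (Fin n) → Fin n → Set
  SuffixGap L u = ∃ λ k → k ∈ L × pos u < pos k × ¬ G k u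

  record Pick (L : List (Fin n)) (v : Fin n) (L' : List (Fin n)) : Set where
    field
      picked∈      : v ∈ L
      picked∉      : v ∉ L'
      remaining⊆   : ∀ {y} → y ∈ L' → y ∈ L
      remaining⊇   : ∀ {y} → y ∈ L → y ≢ v → y ∈ L'
      sorted       : Sorted L'
      length-suc   : length L ≡ suc (length L')
      suffixConn   : FullySuffixConnected L v
      earlierGap   : ∀ {u} → u ∈ L → pos u < pos v → SuffixGap L u

  PickSpec : List (Fin n) → Maybe (Fin n × List (Fin n)) → Set
  PickSpec L nothing         = L ≡ []
  PickSpec L (just (v , L')) = Pick L v L'

  pick-correct : ∀ L → Sorted L → PickSpec L (pick L)
  pick-correct []         _ = refl
  pick-correct (u ∷ rest) (u<rest ∷ rest-sorted) with all? (λ v → G? v u) rest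
  ... | yes rest→u = record
    { picked∈    = here refl
    ; picked∉    = λ u∈rest → <-irrefl refl (All.lookup u<rest u∈rest)
    ; remaining⊆ = there
    ; remaining⊇ = λ { (here refl) u≢u → ⊥-elim (u≢u refl) ; (there y∈rest) _ → y∈rest }
    ; sorted     = rest-sorted
    ; length-suc = refl
    ; suffixConn = λ { (here refl) u<u → ⊥-elim (<-irrefl refl u<u)
                     ; (there y∈rest) _ → All.lookup rest→u y∈rest }
    ; earlierGap = λ { (here refl) u<u → ⊥-elim (<-irrefl refl u<u)
                     ; (there y∈rest) y<u → ⊥-elim (<-irrefl refl (<-trans y<u (All.lookup u<rest y∈rest))) }
    }
  ... | no ¬rest→u with pick rest | pick-correct rest rest-sorted
  ...   | nothing         | refl = ⊥-elim (¬rest→u All.[])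
  ...   | just (v , rest') | p    = record
    { picked∈    = there picked∈
    ; picked∉    = λ { (here refl) → <-irrefl refl u<v ; (there v∈rest') → picked∉ v∈rest' }
    ; remaining⊆ = λ { (here refl) → here refl ; (there y∈rest') → there (remaining⊆ y∈rest') }
    ; remaining⊇ = λ { (here refl) _ → here refl ; (there y∈rest) y≢v → there (remaining⊇ y∈rest y≢v) }
    ; sorted     = All.tabulate (λ y∈rest' → All.lookup u<rest (remaining⊆ y∈rest')) ∷ sorted
    ; length-suc = cong suc length-suc
    ; suffixConn = λ { (here refl) v<u → ⊥-elim (<-irrefl refl (<-trans v<u u<v))
                     ; (there y∈rest) v<y → suffixConn y∈rest v<y }
    ; earlierGap = λ { (here refl) _ → uGap ; (there y∈rest) y<v → widen (earlierGap y∈rest y<v) }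
    }
    where
      open Pick p
      u<v : pos u < pos v
      u<v = All.lookup u<rest picked∈
      uGap : SuffixGap (u ∷ rest) u
      uGap with find (¬All⇒Any¬ (λ k → G? k u) rest ¬rest→u)
      ... | k , k∈rest , ¬Gku = k , there k∈rest , All.lookup u<rest k∈rest , ¬Gku
      widen : ∀ {y} → SuffixGap rest y → SuffixGap (u ∷ rest) y
      widen (k , k∈rest , y<k , ¬Gky) = k , there k∈rest , y<k , ¬Gky

  -- An arc v → x meets a gap witness k of x. If k lies γ-after v, transitivity
  -- through v gives k → x; otherwise umbrella-freeness gives v → k, with k strictly
  -- γ-closer to v than x, and the descent must stop.
  picked-no-out-arc : ∀ {L v L'} → Pick L v L' → ∀ {x} → x ∈ L → ¬ G v x
  picked-no-out-arc {L} {v} p {x} = descend x (<-wellFounded (pos v ∸ pos x))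
    where
      descend : ∀ x → Acc _<_ (pos v ∸ pos x) → x ∈ L → ¬ G v x
      descend x (acc closer) x∈L Gvx with Pick.earlierGap p x∈L (topological x v Gvx)
      ... | k , k∈L , x<k , ¬Gkx with <-cmp (pos k) (pos v)
      ... | tri< k<v _ _ =
        [ ¬Gkx , descend k (closer (∸-monoʳ-< x<k (<⇒≤ k<v))) k∈L ]′ (umbrellaFree x v k Gvx x<k k<v)
      ... | tri≈ _ k≡v _ = ¬Gkx (subst (λ w → G w x) (sym (pos-injective k≡v)) Gvx)
      ... | tri> _ _ v<k = ¬Gkx (G-trans (Pick.suffixConn p k∈L v<k) Gvx)

  Agrees : (Fin n → ℕ) → Fin n → Fin n → Set
  Agrees σ x y = (G y x → σ x ≤ σ y) × (pos x < pos y → ¬ G y x → σ y < σ x)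

  RunEndsAt : List (Fin n) → (Fin n → ℕ) → ℕ → Maybe (Fin n) → Set
  RunEndsAt L σ α nothing  = ∀ x → x ∈ L
  RunEndsAt L σ α (just p) = ∀ x → x ∉ L → σ x ≡ α → pos x ≤ pos p

  -- L lists the remaining vertices; the processed ones are those not in L.
  record Invariant (L : List (Fin n)) (prev : Maybe (Fin n)) (α : ℕ) (σ : Fin n → ℕ) : Set where
    field
      sorted    : Sorted L
      closed    : ∀ x y → y ∉ L → G y x → x ∉ L
      suffixArc : ∀ x y → x ∉ L → y ∈ L → pos x < pos y → G y x
      bounded   : ∀ x → x ∉ L → σ x ≤ α
      runEnd    : RunEndsAt L σ α prev
      agrees    : ∀ x y → x ∉ L → y ∉ L → Agrees σ x y

  α≤nextα : ∀ prev v α → α ≤ nextα prev v α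
  α≤nextα nothing  v α = ≤-refl
  α≤nextα (just p) v α with pos v <ᵇ pos p
  ... | true  = n≤1+n α
  ... | false = ≤-refl

  processed-later<nextα : ∀ {L prev α σ} → Invariant L prev α σ →
    ∀ {v x} → v ∈ L → x ∉ L → pos v < pos x → σ x < nextα prev v α
  processed-later<nextα {prev = nothing} inv {x = x} _ x∉L _ = ⊥-elim (x∉L (Invariant.runEnd inv x))
  processed-later<nextα {prev = just p} {α} {σ} inv {v} {x} _ x∉L v<x with pos v <ᵇ pos p in v≮ᵇp
  ... | true  = s≤s (Invariant.bounded inv x x∉L)
  ... | false with σ x ≟ α
  ...   | yes σx≡α = ⊥-elim (subst T v≮ᵇp (<⇒<ᵇ (<-≤-trans v<x (Invariant.runEnd inv x x∉L σx≡α))))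
  ...   | no σx≢α  = ≤∧≢⇒< (Invariant.bounded inv x x∉L) σx≢α

  invariant-step : ∀ {L prev α σ v L'} → Invariant L prev α σ → Pick L v L' →
    Invariant L' (just v) (nextα prev v α) (update σ v (nextα prev v α))
  invariant-step {L} {prev} {α} {σ} {v} {L'} inv p = record
    { sorted    = sorted
    ; closed    = closed′
    ; suffixArc = suffixArc′
    ; bounded   = bounded′
    ; runEnd    = runEnd′
    ; agrees    = agrees′
    }
    where
      open Pick p
      α′ = nextα prev v α
      σ′ = update σ v α′
      α≤α′ = α≤nextα prev v α

      wasProcessed : ∀ {x} → x ∉ L' → x ≢ v → x ∉ L
      wasProcessed x∉L' x≢v x∈L = x∉L' (remaining⊇ x∈L x≢v)
      staysProcessed : ∀ {x} → x ∉ L → x ∉ L'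
      staysProcessed x∉L x∈L' = x∉L (remaining⊆ x∈L')

      closed′ : ∀ x y → y ∉ L' → G y x → x ∉ L'
      closed′ x y y∉L' Gyx with y ≟ᶠ v
      ... | yes refl = staysProcessed (λ x∈L → picked-no-out-arc p x∈L Gyx)
      ... | no y≢v   = staysProcessed (Invariant.closed inv x y (wasProcessed y∉L' y≢v) Gyx)

      suffixArc′ : ∀ x y → x ∉ L' → y ∈ L' → pos x < pos y → G y x
      suffixArc′ x y x∉L' y∈L' x<y with x ≟ᶠ v
      ... | yes refl = suffixConn (remaining⊆ y∈L') x<y
      ... | no x≢v   = Invariant.suffixArc inv x y (wasProcessed x∉L' x≢v) (remaining⊆ y∈L') x<y

      bounded′ : ∀ x → x ∉ L' → σ′ x ≤ α′
      bounded′ x x∉L' with x ≟ᶠ v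
      ... | yes refl = ≤-refl
      ... | no x≢v   = ≤-trans (Invariant.bounded inv x (wasProcessed x∉L' x≢v)) α≤α′

      runEnd′ : ∀ x → x ∉ L' → σ′ x ≡ α′ → pos x ≤ pos v
      runEnd′ x x∉L' σ′x≡α′ with x ≟ᶠ v
      ... | yes refl = ≤-refl
      ... | no x≢v   = ≮⇒≥ λ v<x →
        <-irrefl σ′x≡α′ (processed-later<nextα inv picked∈ (wasProcessed x∉L' x≢v) v<x)

      agrees′ : ∀ x y → x ∉ L' → y ∉ L' → Agrees σ′ x y
      agrees′ x y x∉L' y∉L' with x ≟ᶠ v | y ≟ᶠ v
      ... | yes refl | yes refl = (λ Gvv → ⊥-elim (irreflexive Gvv)) , (λ v<v _ → ⊥-elim (<-irrefl refl v<v))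
      ... | yes refl | no y≢v   =
            (λ Gyv → ⊥-elim (Invariant.closed inv v y (wasProcessed y∉L' y≢v) Gyv picked∈))
          , (λ v<y _ → processed-later<nextα inv picked∈ (wasProcessed y∉L' y≢v) v<y)
      ... | no x≢v   | yes refl =
            (λ _ → ≤-trans (Invariant.bounded inv x (wasProcessed x∉L' x≢v)) α≤α′)
          , (λ x<v ¬Gvx → ⊥-elim (¬Gvx (Invariant.suffixArc inv x v (wasProcessed x∉L' x≢v) picked∈ x<v)))
      ... | no x≢v   | no y≢v   = Invariant.agrees inv x y (wasProcessed x∉L' x≢v) (wasProcessed y∉L' y≢v)

  loop-agrees : ∀ k L prev α σ → length L ≤ k → Invariant L prev α σ →
                ∀ x y → Agrees (loop k L prev α σ) x y
  loop-agrees zero    []      prev α σ _  inv x y = Invariant.agrees inv x y (λ ()) (λ ())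
  loop-agrees (suc k) L       prev α σ |L|≤ inv x y with pick L | pick-correct L (Invariant.sorted inv)
  ... | nothing       | refl = Invariant.agrees inv x y (λ ()) (λ ())
  ... | just (v , L') | p    =
    loop-agrees k L' (just v) (nextα prev v α) (update σ v (nextα prev v α))
      (≤-pred (subst (_≤ suc k) (Pick.length-suc p) |L|≤)) (invariant-step inv p) x y

  initial : List (Fin n)
  initial = map g⁻¹ (allFin n)

  ∈-initial : ∀ x → x ∈ initial
  ∈-initial x = subst (_∈ initial) (strictlyInverseʳ x) (∈-map⁺ g⁻¹ (∈-allFin (g x)))

  initial-sorted : Sorted initial
  initial-sorted = map⁺ (tabulate⁺-< λ {i} {j} i<j → subst₂ _<_ (sym (pos-g⁻¹ i)) (sym (pos-g⁻¹ j)) i<j)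

  length-initial : length initial ≡ n
  length-initial = trans (length-map g⁻¹ (allFin n)) (length-tabulate (λ i → i))

  invariant-initial : Invariant initial nothing 1 (λ _ → 0)
  invariant-initial = record
    { sorted    = initial-sorted
    ; closed    = λ _ y y∉ _ → ⊥-elim (y∉ (∈-initial y))
    ; suffixArc = λ x _ x∉ _ _ → ⊥-elim (x∉ (∈-initial x))
    ; bounded   = λ x x∉ → ⊥-elim (x∉ (∈-initial x))
    ; runEnd    = ∈-initial
    ; agrees    = λ x _ x∉ _ → ⊥-elim (x∉ (∈-initial x))
    }

  assignment-agrees : ∀ x y → Agrees assignment x y
  assignment-agrees =
    loop-agrees n initial nothing 1 (λ _ → 0) (≤-reflexive length-initial) invariant-initial

  greedyAssign-isIso : IsIso (PermArc greedyAssign) G g⁻¹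
  greedyAssign-isIso i j = mk⇔ toArc fromArc
    where
      toPos : toℕ j < toℕ i → pos (g⁻¹ j) < pos (g⁻¹ i)
      toPos = subst₂ _<_ (sym (pos-g⁻¹ j)) (sym (pos-g⁻¹ i))
      toArc : PermArc greedyAssign i j → G (g⁻¹ i) (g⁻¹ j)
      toArc (j<i , σj≤σi) with G? (g⁻¹ i) (g⁻¹ j)
      ... | yes arc = arc
      ... | no ¬arc = ⊥-elim (<⇒≱ (proj₂ (assignment-agrees (g⁻¹ j) (g⁻¹ i)) (toPos j<i) ¬arc) σj≤σi)
      fromArc : G (g⁻¹ i) (g⁻¹ j) → PermArc greedyAssign i j
      fromArc arc = subst₂ _<_ (pos-g⁻¹ j) (pos-g⁻¹ i) (topological _ _ arc)
                  , proj₁ (assignment-agrees (g⁻¹ j) (g⁻¹ i)) arc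

lemma4 : (n : ℕ) (G : Digraph n) (G? : Decidable G) (γ : Ordering n) →
    IsPermutationDAG G → IsTopological G γ → IsUmbrellaFree G γ →
    IsIso (PermArc (GreedyAssign G G? γ)) G (Inverse.from γ)
lemma4 n G G? γ permDAG topological umbrellaFree =
  GreedyAssignCorrect.greedyAssign-isIso G G? γ (IsPermutationDAG⇒trans G permDAG) topological umbrellaFree
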